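{- Let $n\in\mathbb{Z}\setminus\{0\}$ with $n\geqslant2$ if $n>0$, and let $k,r$ be positive integers. Then $$S(n;\{r\}^k)=\sum_{l=1}^k\sum_{\substack{a_1+\cdots+a_l=k\\ a_i>0}}\frac{k!}{a_1!\cdots a_l!}\,\zeta(n,ra_1,\ldots,ra_l),$$ and $$S(n;\{ -r\}^k)=(-1)^k\sum_{l=1}^k\sum_{\substack{a_1+\cdots+a_l=k\\ a_i>0}}\frac{k!}{a_1!\cdots a_l!}\,\zeta(n,\widetilde{ra_1},\ldots,\widetilde{ra_l}),$$ where $\widetilde{ra_i}=ra_i$ if $a_i$ is even and $\widetilde{ra_i}=-ra_i$ if $a_i$ is odd.
   Context: $\{s\}^k$ denotes the string $s$ repeated $k$ times. For integers $k,r\geqslant 1$ let $H_k^{(r)}=\sum_{j=1}^k j^{ -r}$ and $\overline{H}_k^{(r)}=\sum_{j=1}^k (-1)^{j+1}j^{ -r}$; for nonzero integer $r$ put $X_k^{(r)}=H_k^{(r)}$ if $r>0$, $X_k^{(r)}=\overline{H}_k^{(-r)}$ if $r<0$. For nonzero integers $n,r_1,\ldots,r_l$ (with $n\geqslant2$ if $n>0$): $S(n;r_1,\ldots,r_l)=\sum_{k\geqslant1}\frac{X_k^{(r_1)}\cdots X_k^{(r_l)}}{(k+1)^n}$ if $n>0$, and $S(n;r_1,\ldots,r_l)=\sum_{k\geqslant1}(-1)^{k+1}\frac{X_k^{(r_1)}\cdots X_k^{(r_l)}}{(k+1)^{|n|}}$ if $n<0$. For nonzero integers $k_1,\ldots,k_d$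 with $k_1\neq1$, $\zeta(k_1,\ldots,k_d)=\sum_{m_1>\cdots>m_d>0}\prod_i\operatorname{sgn}(k_i)^{m_i}m_i^{ -|k_i|}$ (the paper writes a negative entry $-k$ as $\bar k$). -}

module Defs where

open import Data.Nat as ℕ using (ℕ; zero; suc; _!; _∸_; _^_)
open import Data.Nat.Properties using (_!≢0; m^n≢0)
open import Data.Integer as ℤ using (ℤ; +_; -[1+_]) renaming (∣_∣ to ∣_∣ℤ)
open import Data.Rational using (ℚ; 0ℚ; 1ℚ; _+_; _*_; _-_; -_; _/_; ∣_∣; _<_)
open import Data.Bool using (Bool; true; false; if_then_else_)
open import Data.List using (List; []; _∷_; map; concatMap; upTo; foldr)
open import Data.Product using (∃)

sum1to : ℕ → (ℕ → ℚ) → ℚ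
sum1to zero    f = 0ℚ
sum1to (suc N) f = sum1to N f + f (suc N)

sumL : List ℚ → ℚ
sumL = foldr _+_ 0ℚ

prodL : List ℚ → ℚ
prodL = foldr _*_ 1ℚ

neg1^ : ℕ → ℚ
neg1^ zero    = 1ℚ
neg1^ (suc m) = - neg1^ m

-- 1 / m^s  (only used for m ≥ 1; value 0 at m = 0 is irrelevant)
recipPow : ℕ → ℕ → ℚ
recipPow zero    s = 0ℚ
recipPow (suc m) s = (+ 1 / (suc m ^ s)) {{m^n≢0 (suc m) s}}

-- X_k^{(r)}: H_k^{(r)} for r > 0, alternating \bar H_k^{(-r)} for r < 0
X : ℤ → ℕ → ℚ
X (+ r)      k = sum1to k (λ j → recipPow j r)
X -[1+ r ]   k = sum1to k (λ j → neg1^ (suc j) * recipPow j (suc r))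

S-partial : ℤ → List ℤ → ℕ → ℚ
S-partial (+ n)    rs N =
  sum1to N (λ k → prodL (map (λ r → X r k) rs) * recipPow (suc k) n)
S-partial -[1+ n ] rs N =
  sum1to N (λ k → neg1^ (suc k) * prodL (map (λ r → X r k) rs) * recipPow (suc k) (suc n))

sgn^ : ℤ → ℕ → ℚ
sgn^ (+ _)      m = 1ℚ
sgn^ -[1+ _ ]   m = neg1^ m

-- Truncated (alternating) multiple zeta value:
--   ζ_{≤M}(k_1,...,k_d) = Σ_{M ≥ m_1 > ... > m_d > 0} Π sgn(k_i)^{m_i} m_i^{-|k_i|}
ζ-trunc : ℕ → List ℤ → ℚ
ζ-trunc M []       = 1ℚ
ζ-trunc M (k ∷ ks) = sum1to M (λ m → sgn^ k m * recipPow m ∣ k ∣ℤ * ζ-trunc (m ∸ 1) ks)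

-- Compositions of k: lists (a_1,...,a_l) of positive integers with a_1+...+a_l = k.
-- compsF f k (fuel f ≥ k): first part is suc a with a ∈ {0,...,k-1}.
compsF : ℕ → ℕ → List (List ℕ)
compsF _       zero    = [] ∷ []
compsF zero    (suc k) = []
compsF (suc f) (suc k) = concatMap (λ a → map (suc a ∷_) (compsF f (k ∸ a))) (upTo (suc k))

compositions : ℕ → List (List ℕ)
compositions k = compsF k k

recipFact : ℕ → ℚ
recipFact a = (+ 1 / (a !)) {{a !≢0}}

multinomial : ℕ → List ℕ → ℚ
multinomial k as = ((+ (k !)) / 1) * prodL (map recipFact as)

isEven : ℕ → Bool
isEven zero          = true
isEven (suc zero)    = false
isEven (suc (suc n)) = isEven n

tilde : ℕ → ℕ → ℤ
tilde r a = if isEven a then + (r ℕ.* a) else ℤ.- (+ (r ℕ.* a))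

-- Equality of the limits of two sequences of partial sums (as real numbers):
-- their difference tends to 0.
_≈lim_ : (ℕ → ℚ) → (ℕ → ℚ) → Set
f ≈lim g = ∀ (ε : ℚ) → 0ℚ < ε → ∃ λ N → ∀ M → N ℕ.≤ M → ∣ f M - g M ∣ < ε

-- N-th partial sums of the right-hand sides (MZVs truncated at m_1 ≤ N+1,
-- matching the range (k+1) ≤ N+1 of the left-hand side; any truncation has the same limit).
RHS-pos : ℤ → ℕ → ℕ → ℕ → ℚ
RHS-pos n k r N =
  sumL (map (λ as → multinomial k as * ζ-trunc (suc N) (n ∷ map (λ a → + (r ℕ.* a)) as))
            (compositions k))

RHS-neg : ℤ → ℕ → ℕ → ℕ → ℚ
RHS-neg n k r N =
  neg1^ k * sumL (map (λ as → multinomial k as * ζ-trunc (suc N) (n ∷ map (tilde r) as))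
                      (compositions k))

module Submission where

-- The partial sums of the two sides coincide. The N-th partial sum of S(n;{ρ}^k) is
-- Σ_{2 ≤ m ≤ N+1} c_n(m) X_{m-1}^k with c_n(m) = (±1)^m m^{-|n|}, and X_{m-1} = y₁ + ⋯ + y_{m-1} for
-- y_j = j^{-r} if ρ = r, resp. X_{m-1} = -(y₁ + ⋯ + y_{m-1}) for y_j = (-1)^j j^{-r} if ρ = -r.
-- By the multinomial theorem, grouping equal indices, (y₁ + ⋯ + y_{m-1})^k is the sum over the
-- compositions (a₁,…,a_l) of k of k!/(a₁!⋯a_l!) Σ_{m > j₁ > ⋯ > j_l > 0} y_{j₁}^{a₁} ⋯ y_{j_l}^{a_l},
-- and y_j^a is the factor that a summation index j contributes to ζ at the index ra, resp. \widetilde{ra}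
-- (((-1)^j)^a only depends on the parity of a). The multinomial expansion is proved by induction on the
-- number of variables: splitting off the terms whose largest index is the last variable reduces it to the
-- binomial theorem.

open import Defs
open import Algebra.Bundles using (CommutativeRing)
open import Data.Nat as ℕ using (ℕ; zero; suc; _∸_; _!; _≤_; s≤s; NonZero)
open import Data.Nat.Properties as ℕ using (_!≢0; _!*_!≢0; m^n≢0; m*n≢0; m∸n≤m)
open import Data.Nat.Combinatorics using (_C_; k![n∸k]!∣n!)
open import Data.Nat.Combinatorics.Specification using (nCk≡n!/k![n-k]!)
open import Data.Nat.DivMod using (m/n*n≡m)
open import Data.Integer as ℤ using (ℤ; +_; -_; -[1+_])
  renaming (∣_∣ to ∣_∣ℤ; _<_ to _<ℤ_; _≤_ to _≤ℤ_)
import Data.Integer.Properties as ℤ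
open import Data.Rational as ℚ using (ℚ; 0ℚ; 1ℚ; _+_; _*_; _-_; _/_; ∣_∣; _<_; toℚᵘ; fromℚᵘ)
open import Data.Rational.Properties
import Data.Rational.Unnormalised as ℚᵘ
import Data.Rational.Unnormalised.Properties as ℚᵘ
open import Data.Rational.Solver using (module +-*-Solver)
open import Data.Fin using (toℕ)
open import Data.Fin.Properties using (toℕ≤pred[n])
open import Data.List using (List; []; _∷_; map; concatMap; applyUpTo; upTo; _++_; replicate)
open import Data.Bool using (true; false; if_then_else_)
open import Data.Product using (_×_; _,_)
open import Relation.Binary.PropositionalEquality

open CommutativeRing +-*-commutativeRing
  using (commutativeSemiring; semiring; +-monoid; +-commutativeMonoid; +-commutativeSemigroup; *-commutativeSemigroup)
open import Algebra.Properties.Semiring.Mult semiring using (×-assoc-*; ×1-homo-*) renaming (_×_ to _·_)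
open import Algebra.Properties.CommutativeSemiring.Exp commutativeSemiring using (_^_; ^-assocʳ; ^-distrib-*)
open import Algebra.Properties.CommutativeSemiring.Binomial commutativeSemiring using (theorem)
open import Algebra.Properties.Monoid.Sum +-monoid
  using (sum-syntax; sum⁺-syntax; sum-cong-≋; sum-replicate-zero)
open import Algebra.Properties.CommutativeMonoid.Sum +-commutativeMonoid using (∑-distrib-+)
open import Algebra.Properties.Semiring.Sum semiring using (*-distribʳ-sum)
open import Algebra.Properties.CommutativeSemigroup +-commutativeSemigroup
  using () renaming (interchange to +-interchange)
open import Algebra.Properties.CommutativeSemigroup *-commutativeSemigroup
  using () renaming (x∙yz≈y∙xz to *-left-comm; xy∙z≈xz∙y to *-right-comm)

fromℕ : ℕ → ℚ
fromℕ n = + n / 1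

fromℚᵘ-homo-+ : ∀ p q → fromℚᵘ (p ℚᵘ.+ q) ≡ fromℚᵘ p + fromℚᵘ q
fromℚᵘ-homo-+ p q = toℚᵘ-injective (ℚᵘ.≃-trans (toℚᵘ-fromℚᵘ (p ℚᵘ.+ q))
  (ℚᵘ.≃-sym (ℚᵘ.≃-trans (toℚᵘ-homo-+ (fromℚᵘ p) (fromℚᵘ q))
                         (ℚᵘ.+-cong (toℚᵘ-fromℚᵘ p) (toℚᵘ-fromℚᵘ q)))))

fromℚᵘ-homo-* : ∀ p q → fromℚᵘ (p ℚᵘ.* q) ≡ fromℚᵘ p * fromℚᵘ q
fromℚᵘ-homo-* p q = toℚᵘ-injective (ℚᵘ.≃-trans (toℚᵘ-fromℚᵘ (p ℚᵘ.* q))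
  (ℚᵘ.≃-sym (ℚᵘ.≃-trans (toℚᵘ-homo-* (fromℚᵘ p) (fromℚᵘ q))
                         (ℚᵘ.*-cong (toℚᵘ-fromℚᵘ p) (toℚᵘ-fromℚᵘ q)))))

fromℕ-suc : ∀ n → fromℕ (suc n) ≡ 1ℚ + fromℕ n
fromℕ-suc n = trans (fromℚᵘ-cong suc≃1+) (fromℚᵘ-homo-+ ℚᵘ.1ℚᵘ (+ n ℚᵘ./ 1))
  where
  suc≃1+ : + suc n ℚᵘ./ 1 ℚᵘ.≃ ℚᵘ.1ℚᵘ ℚᵘ.+ + n ℚᵘ./ 1
  suc≃1+ = ℚᵘ.*≡* (trans (ℤ.*-identityʳ (+ suc n))
    (sym (trans (ℤ.*-identityʳ _) (cong (ℤ._+_ (+ 1)) (ℤ.*-identityʳ (+ n))))))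

fromℕ≡·1 : ∀ n → fromℕ n ≡ n · 1ℚ
fromℕ≡·1 zero    = refl
fromℕ≡·1 (suc n) = trans (fromℕ-suc n) (cong (_+_ 1ℚ) (fromℕ≡·1 n))

·≡fromℕ* : ∀ n x → n · x ≡ fromℕ n * x
·≡fromℕ* n x = begin
  n · x          ≡⟨ cong (n ·_) (*-identityˡ x) ⟨
  n · (1ℚ * x)   ≡⟨ ×-assoc-* n 1ℚ x ⟨
  (n · 1ℚ) * x   ≡⟨ cong (_* x) (fromℕ≡·1 n) ⟨
  fromℕ n * x    ∎
  where open ≡-Reasoning

fromℕ-* : ∀ m n → fromℕ (m ℕ.* n) ≡ fromℕ m * fromℕ n
fromℕ-* m n = begin
  fromℕ (m ℕ.* n)        ≡⟨ fromℕ≡·1 (m ℕ.* n) ⟩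
  (m ℕ.* n) · 1ℚ         ≡⟨ ×1-homo-* m n ⟩
  (m · 1ℚ) * (n · 1ℚ)    ≡⟨ cong₂ _*_ (fromℕ≡·1 m) (fromℕ≡·1 n) ⟨
  fromℕ m * fromℕ n      ∎
  where open ≡-Reasoning

fromℕ*1/≡1 : ∀ n .{{_ : NonZero n}} → fromℕ n * (+ 1 / n) ≡ 1ℚ
fromℕ*1/≡1 (suc n) = trans (sym (fromℚᵘ-homo-* p (ℚᵘ.1/ p))) (fromℚᵘ-cong (ℚᵘ.*-inverseʳ p))
  where p = + suc n ℚᵘ./ 1

1/-* : ∀ m n .{{_ : NonZero m}} .{{_ : NonZero n}} →
       (+ 1 / (m ℕ.* n)) {{m*n≢0 m n}} ≡ (+ 1 / m) * (+ 1 / n)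
1/-* (suc m) (suc n) = fromℚᵘ-homo-* (+ 1 ℚᵘ./ suc m) (+ 1 ℚᵘ./ suc n)

recipFact-cancel : ∀ n → fromℕ (n !) * recipFact n ≡ 1ℚ
recipFact-cancel n = fromℕ*1/≡1 (n !) {{n !≢0}}

recipPow≡^ : ∀ m s → recipPow (suc m) s ≡ (+ 1 / suc m) ^ s
recipPow≡^ m zero    = refl
recipPow≡^ m (suc s) =
  trans (1/-* (suc m) (suc m ℕ.^ s) {{_}} {{m^n≢0 (suc m) s}}) (cong ((+ 1 / suc m) *_) (recipPow≡^ m s))

recipPow-* : ∀ m r a → recipPow (suc m) (r ℕ.* a) ≡ recipPow (suc m) r ^ a
recipPow-* m r a = begin
  recipPow (suc m) (r ℕ.* a)   ≡⟨ recipPow≡^ m (r ℕ.* a) ⟩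
  (+ 1 / suc m) ^ (r ℕ.* a)    ≡⟨ ^-assocʳ (+ 1 / suc m) r a ⟨
  ((+ 1 / suc m) ^ r) ^ a      ≡⟨ cong (_^ a) (recipPow≡^ m r) ⟨
  recipPow (suc m) r ^ a       ∎
  where open ≡-Reasoning

neg1^-square : ∀ m → neg1^ m * neg1^ m ≡ 1ℚ
neg1^-square zero    = refl
neg1^-square (suc m) = trans (neg-*-neg (neg1^ m) (neg1^ m)) (neg1^-square m)
  where open +-*-Solver
        neg-*-neg : ∀ u v → ℚ.- u * ℚ.- v ≡ u * v
        neg-*-neg = solve 2 (λ u v → :- u :* :- v := u :* v) refl

neg1^-^ : ∀ m a → neg1^ m ^ a ≡ (if isEven a then 1ℚ else neg1^ m)
neg1^-^ m zero          = refl
neg1^-^ m (suc zero)    = *-identityʳ (neg1^ m)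
neg1^-^ m (suc (suc a)) = begin
  neg1^ m * (neg1^ m * neg1^ m ^ a)   ≡⟨ *-assoc (neg1^ m) _ _ ⟨
  neg1^ m * neg1^ m * neg1^ m ^ a     ≡⟨ cong (_* neg1^ m ^ a) (neg1^-square m) ⟩
  1ℚ * neg1^ m ^ a                    ≡⟨ *-identityˡ _ ⟩
  neg1^ m ^ a                         ≡⟨ neg1^-^ m a ⟩
  (if isEven a then 1ℚ else neg1^ m)  ∎
  where open ≡-Reasoning

neg-^ : ∀ x a → (ℚ.- x) ^ a ≡ neg1^ a * x ^ a
neg-^ x zero    = refl
neg-^ x (suc a) = begin
  ℚ.- x * (ℚ.- x) ^ a        ≡⟨ cong (ℚ.- x *_) (neg-^ x a) ⟩
  ℚ.- x * (neg1^ a * x ^ a)  ≡⟨ neg-swap x (neg1^ a) (x ^ a) ⟩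
  ℚ.- neg1^ a * (x * x ^ a)  ∎
  where open ≡-Reasoning
        open +-*-Solver
        neg-swap : ∀ u v w → ℚ.- u * (v * w) ≡ ℚ.- v * (u * w)
        neg-swap = solve 3 (λ u v w → :- u :* (v :* w) := :- v :* (u :* w)) refl

private variable
  A B : Set

sumL-cong : ∀ {g h : A → ℚ} xs → (∀ x → g x ≡ h x) → sumL (map g xs) ≡ sumL (map h xs)
sumL-cong []       g≗h = refl
sumL-cong (x ∷ xs) g≗h = cong₂ _+_ (g≗h x) (sumL-cong xs g≗h)

sumL-zero : ∀ (xs : List A) → sumL (map (λ _ → 0ℚ) xs) ≡ 0ℚ
sumL-zero []       = refl
sumL-zero (x ∷ xs) = trans (+-identityˡ _) (sumL-zero xs)

sumL-*ˡ : ∀ c (g : A → ℚ) xs → sumL (map (λ x → c * g x) xs) ≡ c * sumL (map g xs)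
sumL-*ˡ c g []       = sym (*-zeroʳ c)
sumL-*ˡ c g (x ∷ xs) = trans (cong (_+_ (c * g x)) (sumL-*ˡ c g xs)) (sym (*-distribˡ-+ c (g x) _))

sumL-+ : ∀ (g h : A → ℚ) xs → sumL (map (λ x → g x + h x) xs) ≡ sumL (map g xs) + sumL (map h xs)
sumL-+ g h []       = sym (+-identityˡ 0ℚ)
sumL-+ g h (x ∷ xs) = trans (cong (_+_ (g x + h x)) (sumL-+ g h xs)) (+-interchange (g x) (h x) _ _)

sumL-++ : ∀ (g : A → ℚ) xs ys → sumL (map g (xs ++ ys)) ≡ sumL (map g xs) + sumL (map g ys)
sumL-++ g []       ys = sym (+-identityˡ _)
sumL-++ g (x ∷ xs) ys = trans (cong (_+_ (g x)) (sumL-++ g xs ys)) (sym (+-assoc (g x) _ _))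

sumL-sum1to : ∀ M (g : A → ℕ → ℚ) xs →
            sumL (map (λ x → sum1to M (g x)) xs) ≡ sum1to M (λ m → sumL (map (λ x → g x m) xs))
sumL-sum1to zero    g xs = sumL-zero xs
sumL-sum1to (suc M) g xs = trans (sumL-+ (λ x → sum1to M (g x)) (λ x → g x (suc M)) xs)
                               (cong (_+ sumL (map (λ x → g x (suc M)) xs)) (sumL-sum1to M g xs))

sumL-map : ∀ (g : B → ℚ) (f : A → B) xs → sumL (map g (map f xs)) ≡ sumL (map (λ x → g (f x)) xs)
sumL-map g f []       = refl
sumL-map g f (x ∷ xs) = cong (_+_ (g (f x))) (sumL-map g f xs)

sumL-concatMap : ∀ (g : B → ℚ) (f : A → List B) xs →
                 sumL (map g (concatMap f xs)) ≡ sumL (map (λ x → sumL (map g (f x))) xs)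
sumL-concatMap g f []       = refl
sumL-concatMap g f (x ∷ xs) =
  trans (sumL-++ g (f x) (concatMap f xs)) (cong (_+_ (sumL (map g (f x)))) (sumL-concatMap g f xs))

sumL-applyUpTo : ∀ (g : ℕ → ℚ) f n → sumL (map g (applyUpTo f n)) ≡ ∑[ i < n ] g (f (toℕ i))
sumL-applyUpTo g f zero    = refl
sumL-applyUpTo g f (suc n) = cong (_+_ (g (f 0))) (sumL-applyUpTo g (λ i → f (suc i)) n)

sum1to-cong : ∀ N {g h : ℕ → ℚ} → (∀ j → g (suc j) ≡ h (suc j)) → sum1to N g ≡ sum1to N h
sum1to-cong zero    g≗h = refl
sum1to-cong (suc N) g≗h = cong₂ _+_ (sum1to-cong N g≗h) (g≗h N)

sum1to-*ˡ : ∀ c N (g : ℕ → ℚ) → c * sum1to N g ≡ sum1to N (λ j → c * g j)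
sum1to-*ˡ c zero    g = *-zeroʳ c
sum1to-*ˡ c (suc N) g = trans (*-distribˡ-+ c _ (g (suc N))) (cong (_+ c * g (suc N)) (sum1to-*ˡ c N g))

sum1to-neg : ∀ N (g : ℕ → ℚ) → sum1to N (λ j → ℚ.- g j) ≡ ℚ.- sum1to N g
sum1to-neg zero    g = refl
sum1to-neg (suc N) g =
  trans (cong (_+ ℚ.- g (suc N)) (sum1to-neg N g)) (sym (neg-distrib-+ (sum1to N g) (g (suc N))))

sum1to-suc : ∀ N (g : ℕ → ℚ) → sum1to (suc N) g ≡ g 1 + sum1to N (λ i → g (suc i))
sum1to-suc zero    g = trans (+-identityˡ (g 1)) (sym (+-identityʳ (g 1)))
sum1to-suc (suc N) g = trans (cong (_+ g (suc (suc N))) (sum1to-suc N g)) (+-assoc (g 1) _ _)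

nCk*k!*[n∸k]!≡n! : ∀ {n k} → k ≤ n → (n C k) ℕ.* (k ! ℕ.* (n ∸ k) !) ≡ n !
nCk*k!*[n∸k]!≡n! {n} {k} k≤n = trans (cong (ℕ._* (k ! ℕ.* (n ∸ k) !)) (nCk≡n!/k![n-k]! k≤n))
  (m/n*n≡m {{k !* (n ∸ k) !≢0}} (k![n∸k]!∣n! k≤n))

nCk*recipFact : ∀ {n k} → k ≤ n → fromℕ (n C k) * recipFact n ≡ recipFact k * recipFact (n ∸ k)
nCk*recipFact {n} {k} k≤n = begin
  c * rn                                 ≡⟨ *-identityʳ (c * rn) ⟨
  c * rn * 1ℚ                            ≡⟨ cong (c * rn *_) ones ⟨
  c * rn * ((u * rk) * (v * rv))         ≡⟨ regroup c rn u rk v rv ⟩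
  (c * (u * v) * rn) * (rk * rv)         ≡⟨ cong (λ w → w * rn * (rk * rv)) factorials ⟩
  (fromℕ (n !) * rn) * (rk * rv)         ≡⟨ cong (_* (rk * rv)) (recipFact-cancel n) ⟩
  1ℚ * (rk * rv)                         ≡⟨ *-identityˡ (rk * rv) ⟩
  rk * rv                                ∎
  where
  open ≡-Reasoning
  c = fromℕ (n C k); u = fromℕ (k !); v = fromℕ ((n ∸ k) !)
  rn = recipFact n; rk = recipFact k; rv = recipFact (n ∸ k)
  ones : (u * rk) * (v * rv) ≡ 1ℚ
  ones = cong₂ _*_ (recipFact-cancel k) (recipFact-cancel (n ∸ k))
  factorials : c * (u * v) ≡ fromℕ (n !)
  factorials = begin
    c * (u * v)                           ≡⟨ cong (c *_) (fromℕ-* (k !) ((n ∸ k) !)) ⟨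
    c * fromℕ (k ! ℕ.* (n ∸ k) !)         ≡⟨ fromℕ-* (n C k) _ ⟨
    fromℕ ((n C k) ℕ.* (k ! ℕ.* (n ∸ k) !)) ≡⟨ cong fromℕ (nCk*k!*[n∸k]!≡n! k≤n) ⟩
    fromℕ (n !)                           ∎
  open +-*-Solver
  regroup : ∀ c rn u rk v rv → c * rn * ((u * rk) * (v * rv)) ≡ (c * (u * v) * rn) * (rk * rv)
  regroup = solve 6 (λ c rn u rk v rv →
    c :* rn :* ((u :* rk) :* (v :* rv)) := (c :* (u :* v) :* rn) :* (rk :* rv)) refl

binomialTerm*recipFact : ∀ {n k} → k ≤ n → ∀ x z →
  ((n C k) · (z ^ k * x ^ (n ∸ k))) * recipFact n
  ≡ (z ^ k * recipFact k) * (x ^ (n ∸ k) * recipFact (n ∸ k))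
binomialTerm*recipFact {n} {k} k≤n x z = begin
  ((n C k) · w) * recipFact n                  ≡⟨ cong (_* recipFact n) (·≡fromℕ* (n C k) w) ⟩
  fromℕ (n C k) * w * recipFact n              ≡⟨ *-right-comm (fromℕ (n C k)) w (recipFact n) ⟩
  fromℕ (n C k) * recipFact n * w              ≡⟨ cong (_* w) (nCk*recipFact k≤n) ⟩
  recipFact k * recipFact (n ∸ k) * w
    ≡⟨ shuffle (recipFact k) (recipFact (n ∸ k)) (z ^ k) (x ^ (n ∸ k)) ⟩
  (z ^ k * recipFact k) * (x ^ (n ∸ k) * recipFact (n ∸ k)) ∎
  where
  open ≡-Reasoning
  w = z ^ k * x ^ (n ∸ k)
  open +-*-Solver
  shuffle : ∀ a b c d → a * b * (c * d) ≡ (c * a) * (d * b)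
  shuffle = solve 4 (λ a b c d → a :* b :* (c :* d) := (c :* a) :* (d :* b)) refl

binomial*recipFact : ∀ n (x z : ℚ) → (x + z) ^ n * recipFact n
  ≡ ∑[ k ≤ n ] ((z ^ toℕ k * recipFact (toℕ k)) * (x ^ (n ∸ toℕ k) * recipFact (n ∸ toℕ k)))
binomial*recipFact n x z = begin
  (x + z) ^ n * recipFact n
    ≡⟨ cong (λ w → w ^ n * recipFact n) (+-comm x z) ⟩
  (z + x) ^ n * recipFact n
    ≡⟨ cong (_* recipFact n) (theorem n z x) ⟩
  (∑[ k ≤ n ] ((n C toℕ k) · (z ^ toℕ k * x ^ (n ∸ toℕ k)))) * recipFact n
    ≡⟨ *-distribʳ-sum {suc n} (recipFact n) (λ k → (n C toℕ k) · (z ^ toℕ k * x ^ (n ∸ toℕ k))) ⟩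
  ∑[ k ≤ n ] (((n C toℕ k) · (z ^ toℕ k * x ^ (n ∸ toℕ k))) * recipFact n)
    ≡⟨ sum-cong-≋ {suc n} (λ k → binomialTerm*recipFact (toℕ≤pred[n] k) x z) ⟩
  ∑[ k ≤ n ] ((z ^ toℕ k * recipFact (toℕ k)) * (x ^ (n ∸ toℕ k) * recipFact (n ∸ toℕ k))) ∎
  where open ≡-Reasoning

binomial*recipFact-suc : ∀ k (x z : ℚ) → (x + z) ^ suc k * recipFact (suc k)
  ≡ x ^ suc k * recipFact (suc k)
    + ∑[ a < suc k ] ((z ^ suc (toℕ a) * recipFact (suc (toℕ a)))
                      * (x ^ (k ∸ toℕ a) * recipFact (k ∸ toℕ a)))
binomial*recipFact-suc k x z =
  trans (binomial*recipFact (suc k) x z)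
        (cong (_+ ∑[ a < suc k ] term (toℕ a)) (*-identityˡ (x ^ suc k * recipFact (suc k))))
  where
  term : ℕ → ℚ
  term a = (z ^ suc a * recipFact (suc a)) * (x ^ (k ∸ a) * recipFact (k ∸ a))

recipFacts : List ℕ → ℚ
recipFacts as = prodL (map recipFact as)

module _ (y : ℕ → ℚ) where

  monomialQSym : ℕ → List ℕ → ℚ
  monomialQSym m []       = 1ℚ
  monomialQSym m (a ∷ as) = sum1to m (λ j → y j ^ a * monomialQSym (j ∸ 1) as)

  compositionSum : ℕ → ℕ → ℕ → ℚ
  compositionSum f k m = sumL (map (λ as → recipFacts as * monomialQSym m as) (compsF f k))

  firstPartSum : ℕ → ℕ → ℕ → ℕ → ℚ
  firstPartSum f k a m =
    sumL (map (λ as → recipFacts (suc a ∷ as) * monomialQSym m (suc a ∷ as)) (compsF f (k ∸ a)))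

  compositionSum-suc : ∀ f k m →
    compositionSum (suc f) (suc k) m ≡ ∑[ a < suc k ] firstPartSum f k (toℕ a) m
  compositionSum-suc f k m = begin
    sumL (map G (concatMap h (upTo (suc k))))
      ≡⟨ sumL-concatMap G h (upTo (suc k)) ⟩
    sumL (map (λ a → sumL (map G (h a))) (upTo (suc k)))
      ≡⟨ sumL-applyUpTo (λ a → sumL (map G (h a))) (λ a → a) (suc k) ⟩
    ∑[ a < suc k ] sumL (map G (h (toℕ a)))
      ≡⟨ sum-cong-≋ {suc k} (λ a → sumL-map G (suc (toℕ a) ∷_) (compsF f (k ∸ toℕ a))) ⟩
    ∑[ a < suc k ] firstPartSum f k (toℕ a) m ∎
    where
    open ≡-Reasoning
    G : List ℕ → ℚ
    G as = recipFacts as * monomialQSym m as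
    h : ℕ → List (List ℕ)
    h a = map (suc a ∷_) (compsF f (k ∸ a))

  firstPartSum-zero : ∀ f k a → firstPartSum f k a 0 ≡ 0ℚ
  firstPartSum-zero f k a =
    trans (sumL-cong L (λ as → *-zeroʳ (recipFacts (suc a ∷ as)))) (sumL-zero L)
    where L = compsF f (k ∸ a)

  -- The terms of monomialQSym (suc m) (suc a ∷ as) with top index m + 1 contribute y (m + 1) ^ (a + 1) times
  -- monomialQSym m as.
  firstPartSum-suc : ∀ f k a m → firstPartSum f k a (suc m)
    ≡ firstPartSum f k a m + (y (suc m) ^ suc a * recipFact (suc a)) * compositionSum f (k ∸ a) m
  firstPartSum-suc f k a m = begin
    sumL (map (λ as → G as * (H as + x * monomialQSym m as)) L)
      ≡⟨ sumL-cong L (λ as → distrib (recipFact (suc a)) (recipFacts as) (H as) x (monomialQSym m as)) ⟩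
    sumL (map (λ as → G as * H as + c * (recipFacts as * monomialQSym m as)) L)
      ≡⟨ sumL-+ (λ as → G as * H as) (λ as → c * (recipFacts as * monomialQSym m as)) L ⟩
    firstPartSum f k a m + sumL (map (λ as → c * (recipFacts as * monomialQSym m as)) L)
      ≡⟨ cong (_+_ (firstPartSum f k a m)) (sumL-*ˡ c (λ as → recipFacts as * monomialQSym m as) L) ⟩
    firstPartSum f k a m + c * compositionSum f (k ∸ a) m ∎
    where
    open ≡-Reasoning
    L = compsF f (k ∸ a)
    x = y (suc m) ^ suc a
    c = x * recipFact (suc a)
    G H : List ℕ → ℚ
    G as = recipFacts (suc a ∷ as)
    H as = monomialQSym m (suc a ∷ as)
    open +-*-Solver
    distrib : ∀ r p h x q → r * p * (h + x * q) ≡ r * p * h + x * r * (p * q)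
    distrib = solve 5 (λ r p h x q → r :* p :* (h :+ x :* q) := r :* p :* h :+ x :* r :* (p :* q)) refl

  compositionSum-expansion : ∀ m f k → k ≤ f → compositionSum f k m ≡ sum1to m y ^ k * recipFact k
  compositionSum-expansion m f zero _ = refl
  compositionSum-expansion zero (suc f) (suc k) _ = begin
    compositionSum (suc f) (suc k) 0               ≡⟨ compositionSum-suc f k 0 ⟩
    ∑[ a < suc k ] firstPartSum f k (toℕ a) 0
      ≡⟨ sum-cong-≋ {suc k} (λ a → firstPartSum-zero f k (toℕ a)) ⟩
    ∑[ a < suc k ] 0ℚ                              ≡⟨ sum-replicate-zero (suc k) ⟩
    0ℚ                                             ≡⟨ *-zeroˡ (recipFact (suc k)) ⟨
    0ℚ * recipFact (suc k)                         ≡⟨ cong (_* recipFact (suc k)) (*-zeroˡ (0ℚ ^ k)) ⟨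
    0ℚ ^ suc k * recipFact (suc k)                 ∎
    where open ≡-Reasoning
  compositionSum-expansion (suc m) (suc f) (suc k) (s≤s k≤f) = begin
    compositionSum (suc f) (suc k) (suc m)
      ≡⟨ compositionSum-suc f k (suc m) ⟩
    ∑[ a < suc k ] firstPartSum f k (toℕ a) (suc m)
      ≡⟨ sum-cong-≋ {suc k} (λ a → firstPartSum-suc f k (toℕ a) m) ⟩
    ∑[ a < suc k ] (firstPartSum f k (toℕ a) m + c (toℕ a) * compositionSum f (k ∸ toℕ a) m)
      ≡⟨ ∑-distrib-+ {suc k} (λ a → firstPartSum f k (toℕ a) m)
                             (λ a → c (toℕ a) * compositionSum f (k ∸ toℕ a) m) ⟩
    ∑[ a < suc k ] firstPartSum f k (toℕ a) m
      + ∑[ a < suc k ] (c (toℕ a) * compositionSum f (k ∸ toℕ a) m)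
      ≡⟨ cong₂ _+_ (trans (sym (compositionSum-suc f k m)) (compositionSum-expansion m (suc f) (suc k) (s≤s k≤f)))
                   (sum-cong-≋ {suc k} (λ a → cong (c (toℕ a) *_) (compositionSum-expansion m f (k ∸ toℕ a)
                                                  (ℕ.≤-trans (m∸n≤m k (toℕ a)) k≤f)))) ⟩
    S ^ suc k * recipFact (suc k)
      + ∑[ a < suc k ] (c (toℕ a) * (S ^ (k ∸ toℕ a) * recipFact (k ∸ toℕ a)))
      ≡⟨ binomial*recipFact-suc k S (y (suc m)) ⟨
    (S + y (suc m)) ^ suc k * recipFact (suc k) ∎
    where
    open ≡-Reasoning
    S = sum1to m y
    c : ℕ → ℚ
    c a = y (suc m) ^ suc a * recipFact (suc a)

  multinomial-expansion : ∀ k m →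
    sumL (map (λ as → multinomial k as * monomialQSym m as) (compositions k)) ≡ sum1to m y ^ k
  multinomial-expansion k m = begin
    sumL (map (λ as → multinomial k as * monomialQSym m as) (compositions k))
      ≡⟨ sumL-cong (compositions k) (λ as → *-assoc (fromℕ (k !)) (recipFacts as) (monomialQSym m as)) ⟩
    sumL (map (λ as → fromℕ (k !) * (recipFacts as * monomialQSym m as)) (compositions k))
      ≡⟨ sumL-*ˡ (fromℕ (k !)) (λ as → recipFacts as * monomialQSym m as) (compositions k) ⟩
    fromℕ (k !) * compositionSum k k m
      ≡⟨ cong (fromℕ (k !) *_) (compositionSum-expansion m k k ℕ.≤-refl) ⟩
    fromℕ (k !) * (sum1to m y ^ k * recipFact k)
      ≡⟨ *-left-comm (fromℕ (k !)) (sum1to m y ^ k) (recipFact k) ⟩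
    sum1to m y ^ k * (fromℕ (k !) * recipFact k)
      ≡⟨ cong (sum1to m y ^ k *_) (recipFact-cancel k) ⟩
    sum1to m y ^ k * 1ℚ
      ≡⟨ *-identityʳ (sum1to m y ^ k) ⟩
    sum1to m y ^ k ∎
    where
    open ≡-Reasoning

ζ-weight : ℤ → ℕ → ℚ
ζ-weight k m = sgn^ k m * recipPow m ∣ k ∣ℤ

ζ-weight-tilde : ∀ r a m →
  ζ-weight (tilde (suc r) a) m ≡ (if isEven a then 1ℚ else neg1^ m) * recipPow m (suc r ℕ.* a)
ζ-weight-tilde r zero    m = refl
ζ-weight-tilde r (suc a) m with isEven (suc a)
... | true  = refl
... | false = refl

PowerWeights : (ℕ → ℤ) → (ℕ → ℚ) → Set
PowerWeights f y = ∀ a j → ζ-weight (f a) (suc j) ≡ y (suc j) ^ a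

ζ-trunc≡monomialQSym : ∀ {f y} → PowerWeights f y → ∀ M as → ζ-trunc M (map f as) ≡ monomialQSym y M as
ζ-trunc≡monomialQSym weight M []       = refl
ζ-trunc≡monomialQSym weight M (a ∷ as) =
  sum1to-cong M (λ j → cong₂ _*_ (weight a j) (ζ-trunc≡monomialQSym weight j as))

multinomialSum-ζ-trunc : ∀ n {f y} → PowerWeights f y → ∀ k N →
  sumL (map (λ as → multinomial (suc k) as * ζ-trunc (suc N) (n ∷ map f as)) (compositions (suc k)))
        ≡ sum1to N (λ i → ζ-weight n (suc i) * sum1to i y ^ suc k)
multinomialSum-ζ-trunc n {f} {y} weight k N = begin
  sumL (map (λ as → μ as * sum1to (suc N) (λ m → w m * ζ (m ∸ 1) as)) L)
    ≡⟨ sumL-cong L (λ as → trans (sum1to-*ˡ (μ as) (suc N) _)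
                                 (sum1to-cong (suc N) (λ j → *-left-comm (μ as) (w (suc j)) (ζ j as)))) ⟩
  sumL (map (λ as → sum1to (suc N) (λ m → w m * (μ as * ζ (m ∸ 1) as))) L)
    ≡⟨ sumL-sum1to (suc N) (λ as m → w m * (μ as * ζ (m ∸ 1) as)) L ⟩
  sum1to (suc N) (λ m → sumL (map (λ as → w m * (μ as * ζ (m ∸ 1) as)) L))
    ≡⟨ sum1to-cong (suc N) (λ j → trans (sumL-*ˡ (w (suc j)) (λ as → μ as * ζ j as) L)
                                        (cong (w (suc j) *_) (expansion j))) ⟩
  sum1to (suc N) (λ m → w m * sum1to (m ∸ 1) y ^ suc k)
    ≡⟨ sum1to-suc N (λ m → w m * sum1to (m ∸ 1) y ^ suc k) ⟩
  w 1 * (0ℚ * 0ℚ ^ k) + sum1to N (λ i → w (suc i) * sum1to i y ^ suc k)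
    ≡⟨ cong (_+ sum1to N (λ i → w (suc i) * sum1to i y ^ suc k))
            (trans (cong (w 1 *_) (*-zeroˡ (0ℚ ^ k))) (*-zeroʳ (w 1))) ⟩
  0ℚ + sum1to N (λ i → w (suc i) * sum1to i y ^ suc k)
    ≡⟨ +-identityˡ _ ⟩
  sum1to N (λ i → w (suc i) * sum1to i y ^ suc k) ∎
  where
  open ≡-Reasoning
  L = compositions (suc k)
  μ = multinomial (suc k)
  w = ζ-weight n
  ζ : ℕ → List ℕ → ℚ
  ζ m as = ζ-trunc m (map f as)
  expansion : ∀ j → sumL (map (λ as → μ as * ζ j as) L) ≡ sum1to j y ^ suc k
  expansion j = trans (sumL-cong L (λ as → cong (μ as *_) (ζ-trunc≡monomialQSym weight j as)))
                      (multinomial-expansion y (suc k) j)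

prodL-replicate : ∀ k ρ i → prodL (map (λ r → X r i) (replicate k ρ)) ≡ X ρ i ^ k
prodL-replicate zero    ρ i = refl
prodL-replicate (suc k) ρ i = cong (X ρ i *_) (prodL-replicate k ρ i)

S-partial-replicate : ∀ n ρ k N →
  S-partial n (replicate k ρ) N ≡ sum1to N (λ i → ζ-weight n (suc i) * X ρ i ^ k)
S-partial-replicate (+ n) ρ k N = sum1to-cong N λ i → begin
  prodL (map (λ r → X r (suc i)) (replicate k ρ)) * recipPow (suc (suc i)) n
    ≡⟨ cong (_* recipPow (suc (suc i)) n) (prodL-replicate k ρ (suc i)) ⟩
  X ρ (suc i) ^ k * recipPow (suc (suc i)) n
    ≡⟨ *-comm (X ρ (suc i) ^ k) (recipPow (suc (suc i)) n) ⟩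
  recipPow (suc (suc i)) n * X ρ (suc i) ^ k
    ≡⟨ cong (_* X ρ (suc i) ^ k) (*-identityˡ (recipPow (suc (suc i)) n)) ⟨
  1ℚ * recipPow (suc (suc i)) n * X ρ (suc i) ^ k ∎
  where open ≡-Reasoning
S-partial-replicate -[1+ n ] ρ k N = sum1to-cong N λ i →
  trans (cong (λ p → neg1^ (suc (suc i)) * p * recipPow (suc (suc i)) (suc n)) (prodL-replicate k ρ (suc i)))
        (*-right-comm (neg1^ (suc (suc i))) (X ρ (suc i) ^ k) (recipPow (suc (suc i)) (suc n)))

≡⇒≈lim : ∀ {f g : ℕ → ℚ} → (∀ N → f N ≡ g N) → f ≈lim g
≡⇒≈lim {f} {g} f≗g ε ε>0 = 0 , λ M _ → subst (λ d → ∣ d ∣ < ε) (sym (f-g≡0 M)) ε>0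
  where
  f-g≡0 : ∀ M → f M - g M ≡ 0ℚ
  f-g≡0 M = trans (cong (_- g M) (f≗g M)) (+-inverseʳ (g M))

S-partial≡RHS-pos : ∀ n k r N → S-partial n (replicate (suc k) (+ suc r)) N ≡ RHS-pos n (suc k) (suc r) N
S-partial≡RHS-pos n k r N = trans (S-partial-replicate n (+ suc r) (suc k) N)
  (sym (multinomialSum-ζ-trunc n weight k N))
  where
  weight : PowerWeights (λ a → + (suc r ℕ.* a)) (λ j → recipPow j (suc r))
  weight a j = trans (*-identityˡ _) (recipPow-* j (suc r) a)

S-partial≡RHS-neg : ∀ n k r N → S-partial n (replicate (suc k) -[1+ r ]) N ≡ RHS-neg n (suc k) (suc r) N
S-partial≡RHS-neg n k r N = begin
  S-partial n (replicate K -[1+ r ]) N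
    ≡⟨ S-partial-replicate n -[1+ r ] K N ⟩
  sum1to N (λ i → w (suc i) * X -[1+ r ] i ^ K)
    ≡⟨ sum1to-cong N (λ i → cong (w (suc (suc i)) *_) (X-neg^ (suc i))) ⟩
  sum1to N (λ i → w (suc i) * (neg1^ K * sum1to i y ^ K))
    ≡⟨ sum1to-cong N (λ i → *-left-comm (w (suc (suc i))) (neg1^ K) (sum1to (suc i) y ^ K)) ⟩
  sum1to N (λ i → neg1^ K * (w (suc i) * sum1to i y ^ K))
    ≡⟨ sum1to-*ˡ (neg1^ K) N (λ i → w (suc i) * sum1to i y ^ K) ⟨
  neg1^ K * sum1to N (λ i → w (suc i) * sum1to i y ^ K)
    ≡⟨ cong (neg1^ K *_) (multinomialSum-ζ-trunc n weight k N) ⟨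
  RHS-neg n K (suc r) N ∎
  where
  open ≡-Reasoning
  K = suc k
  w = ζ-weight n
  y : ℕ → ℚ
  y j = neg1^ j * recipPow j (suc r)
  weight : PowerWeights (tilde (suc r)) y
  weight a j = begin
    ζ-weight (tilde (suc r) a) (suc j)
      ≡⟨ ζ-weight-tilde r a (suc j) ⟩
    (if isEven a then 1ℚ else neg1^ (suc j)) * recipPow (suc j) (suc r ℕ.* a)
      ≡⟨ cong₂ _*_ (neg1^-^ (suc j) a) (sym (recipPow-* j (suc r) a)) ⟨
    neg1^ (suc j) ^ a * recipPow (suc j) (suc r) ^ a
      ≡⟨ ^-distrib-* (neg1^ (suc j)) (recipPow (suc j) (suc r)) a ⟨
    y (suc j) ^ a ∎
  X-neg^ : ∀ i → X -[1+ r ] i ^ K ≡ neg1^ K * sum1to i y ^ K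
  X-neg^ i = begin
    X -[1+ r ] i ^ K
      ≡⟨ cong (_^ K) (sum1to-cong i λ j → sym (neg-distribˡ-* (neg1^ (suc j)) (recipPow (suc j) (suc r)))) ⟩
    sum1to i (λ j → ℚ.- y j) ^ K
      ≡⟨ cong (_^ K) (sum1to-neg i y) ⟩
    (ℚ.- sum1to i y) ^ K
      ≡⟨ neg-^ (sum1to i y) K ⟩
    neg1^ K * sum1to i y ^ K ∎

-- The partial sums of the two sides agree exactly.
corollary2p3 : (n : ℤ) → n ≢ + 0 → (+ 0 <ℤ n → + 2 ≤ℤ n) →
    (k r : ℕ) → 1 ≤ k → 1 ≤ r →
    (S-partial n (replicate k (+ r)) ≈lim RHS-pos n k r)
    × (S-partial n (replicate k (- (+ r))) ≈lim RHS-neg n k r)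
corollary2p3 n _ _ (suc k) (suc r) _ _ =
  ≡⇒≈lim (S-partial≡RHS-pos n k r) , ≡⇒≈lim (S-partial≡RHS-neg n k r)
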